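{- Let $G$ be a connected graph, $r$ a vertex of $G$, $t\ge 1$, and $E_r$ a set of edges of $G$ each joining two neighbors of $r$. Suppose $G-r-E_r$ has connected components $G_1,\dots,G_j$ with $j>1$, and let $G'_i$ be the subgraph of $G$ induced by $V(G_i)\cup\{r\}$. Then \[\pi_t(G,r)=\max\Big\{\sum_{i=1}^j \pi_{t_i}(G'_i,r)-j+1\ :\ t_1,\dots,t_j \text{ positive integers},\ \sum_{i=1}^j t_i=t+j-1\Big\}.\]
   Context: A configuration on a graph $H$ is $C:V(H)\to\mathbb{N}$ with size $\sum_vC(v)$; a pebbling step from a vertex with at least two pebbles to a neighbor removes two pebbles there and adds one to the neighbor. $C$ is $t$-fold $r$-solvable if some sequence of pebbling steps places at least $t$ pebbles on $r$; $\pi_t(H,r)$ is the least $m$ such that every configuration of size $m$ on $H$ is $t$-fold $r$-solvable. -}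

module Defs where

open import Data.Nat using (ℕ; zero; suc; _+_; _∸_; _≤_; _<_)
open import Data.Fin using (Fin; _≟_)
open import Data.List using (List; map; allFin)
open import Data.Nat.ListAction using (sum)
open import Data.Product using (Σ; ∃; ∃₂; _×_; _,_)
open import Data.Unit using (⊤)
open import Data.Sum using (_⊎_)
open import Relation.Nullary using (¬_; yes; no)
open import Relation.Binary.PropositionalEquality using (_≡_; _≢_)
open import Relation.Binary.Construct.Closure.ReflexiveTransitive using (Star)

record Graph (n : ℕ) : Set₁ where
  field
    Adj    : Fin n → Fin n → Set
    sym    : ∀ {u v} → Adj u v → Adj v u
    irrefl : ∀ {u} → ¬ Adj u u
open Graph public

Connected : ∀ {n} → Graph n → Set
Connected G = ∀ u v → Star (Adj G) u v

sumFin : ∀ {k} → (Fin k → ℕ) → ℕ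
sumFin {k} f = sum (map f (allFin k))

Config : ℕ → Set
Config n = Fin n → ℕ

size : ∀ {n} → Config n → ℕ
size = sumFin

move : ∀ {n} → Fin n → Fin n → Config n → Config n
move u v C w with w ≟ u | w ≟ v
... | yes _ | _     = C u ∸ 2
... | no _  | yes _ = suc (C v)
... | no _  | no _  = C w

-- Pebbling on the subgraph of G induced by the vertex set S:
-- configurations live on S and steps use edges with both ends in S.
-- (Taking S = everything gives pebbling on G itself.)
Step : ∀ {n} → Graph n → (Fin n → Set) → Config n → Config n → Set
Step G S C C' = ∃₂ λ u v → S u × S v × Adj G u v × 2 ≤ C u × (∀ w → C' w ≡ move u v C w)

Supported : ∀ {n} → (Fin n → Set) → Config n → Set
Supported S C = ∀ v → ¬ S v → C v ≡ 0

Solvable : ∀ {n} → Graph n → (Fin n → Set) → Fin n → ℕ → Config n → Set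
Solvable G S r t C = ∃ λ C' → Star (Step G S) C C' × t ≤ C' r

AllSolvable : ∀ {n} → Graph n → (Fin n → Set) → Fin n → ℕ → ℕ → Set
AllSolvable G S r t m = ∀ C → Supported S C → size C ≡ m → Solvable G S r t C

IsPebblingNumber : ∀ {n} → Graph n → (Fin n → Set) → Fin n → ℕ → ℕ → Set
IsPebblingNumber G S r t m = AllSolvable G S r t m × (∀ m' → m' < m → ¬ AllSolvable G S r t m')

Whole : ∀ {n} → Fin n → Set
Whole _ = ⊤

AdjMinus : ∀ {n} → Graph n → Fin n → (Fin n → Fin n → Set) → Fin n → Fin n → Set
AdjMinus G r Er u v = u ≢ r × v ≢ r × Adj G u v × ¬ Er u v × ¬ Er v u

-- comp : V(G) → Fin j labels the connected components G_1..G_j of G - r - E_r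
-- (value at r is irrelevant): labels are all used, and two vertices ≠ r
-- share a label iff they are joined by a walk in G - r - E_r.
IsComponentLabelling : ∀ {n} → Graph n → Fin n → (Fin n → Fin n → Set) →
                       (j : ℕ) → (Fin n → Fin j) → Set
IsComponentLabelling G r Er j comp =
  (∀ i → ∃ λ v → v ≢ r × comp v ≡ i) ×
  (∀ u v → u ≢ r → v ≢ r →
     (comp u ≡ comp v → Star (AdjMinus G r Er) u v) ×
     (Star (AdjMinus G r Er) u v → comp u ≡ comp v))

PieceSet : ∀ {n j} → Fin n → (Fin n → Fin j) → Fin j → Fin n → Set
PieceSet r comp i v = v ≡ r ⊎ (v ≢ r × comp v ≡ i)

Admissible : (t j : ℕ) → (Fin j → ℕ) → Set
Admissible t j ts = (∀ i → 1 ≤ ts i) × sumFin ts ≡ t + j ∸ 1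

-- M = max { Σ π_{t_i}(G'_i, r) - j + 1 : admissible ts }, with p s i = π_s(G'_i, r)
IsMaxValue : (t j : ℕ) → (ℕ → Fin j → ℕ) → ℕ → Set
IsMaxValue t j p M =
  (∃ λ ts → Admissible t j ts × M ≡ sumFin (λ i → p (ts i) i) ∸ j + 1) ×
  (∀ ts → Admissible t j ts → sumFin (λ i → p (ts i) i) ∸ j + 1 ≤ M)

-- For a configuration C on G, call (kᵢ) a piecewise solution when the pebbles of C on Gᵢ are
-- kᵢ-fold r-solvable in G'ᵢ, and C(r) + Σ kᵢ its weight. Along a pebbling step of G, every
-- piecewise solution of the new configuration is matched by one of the old configuration of at
-- least the same weight: steps inside a piece stay there, steps through r trade a pebble on r for
-- a fold of a piece, and an edge between two pieces lies in E_r, so its source is adjacent to r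
-- and the step is rerouted through r at the cost of one fold. Hence a t-fold solvable
-- configuration has a piecewise solution of weight at least t.
--
-- Lower bound: for a maximising tuple (tᵢ), take tᵢ-unsolvable configurations Dᵢ of size
-- π_{tᵢ}(G'ᵢ) − 1; every piecewise solution of their union has kᵢ + Dᵢ(r) < tᵢ, so weight below t.
-- Upper bound: let kᵢ be the largest s ≤ t with π_s(G'ᵢ) at most the number of pebbles on Gᵢ.
-- The pieces are solved independently, and if C(r) + Σ kᵢ < t, raising each kᵢ by one and
-- padding to total t + j − 1 gives a tuple of value above |C|, since π_{s+e} ≥ π_s + e.

module Submission where

open import Defs
open import Data.Nat using (ℕ; zero; suc; _+_; _∸_; _≤_; _<_; z≤n; s≤s; _≤?_; _<?_)
open import Data.Nat.Properties hiding (_≟_)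
open import Data.Nat.Tactic.RingSolver using (solve-∀)
import Data.Nat.ListAction as List
open import Data.Fin using (Fin; _≟_; toℕ; fromℕ<) renaming (zero to fzero; suc to fsuc)
import Data.Fin.Properties as Finₚ
open import Data.List using (tabulate)
open import Data.List.Properties using (map-tabulate)
open import Data.Vec.Functional using (_∷_; head; tail)
open import Algebra.Properties.CommutativeMonoid.Sum +-0-commutativeMonoid
  using (sum; sum-cong-≗; ∑-distrib-+; ∑-comm; sum-replicate-zero)
open import Data.Product using (∃; ∃₂; _×_; _,_; proj₁; proj₂)
open import Data.Sum using (_⊎_; inj₁; inj₂)
open import Data.Empty using (⊥-elim)
open import Data.Unit using (tt)
open import Function using (_∘_; id)
open import Relation.Unary using (Decidable)
open import Relation.Nullary using (¬_; Dec; yes; no; contradiction; ¬¬-map)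
open import Relation.Binary.PropositionalEquality as ≡
  using (_≡_; _≢_; _≗_; refl; trans; cong; cong₂; subst; subst₂; module ≡-Reasoning)
open import Relation.Binary.Construct.Closure.ReflexiveTransitive as Star
  using (Star; ε; _◅_; _◅◅_)

private
  variable
    k n : ℕ

sumFin≡sum : (f : Fin k → ℕ) → sumFin f ≡ sum f
sumFin≡sum f = trans (cong List.sum (map-tabulate id f)) (sum-tabulate f)
  where
  sum-tabulate : ∀ {k} (f : Fin k → ℕ) → List.sum (tabulate f) ≡ sum f
  sum-tabulate {zero}  f = refl
  sum-tabulate {suc k} f = cong (f fzero +_) (sum-tabulate (f ∘ fsuc))

sum-mono-≤ : {f g : Fin k → ℕ} → (∀ i → f i ≤ g i) → sum f ≤ sum g
sum-mono-≤ {zero}  f≤g = z≤n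
sum-mono-≤ {suc k} f≤g = +-mono-≤ (f≤g fzero) (sum-mono-≤ (f≤g ∘ fsuc))

sum-ones : ∀ k → sum {k} (λ _ → 1) ≡ k
sum-ones zero    = refl
sum-ones (suc k) = cong suc (sum-ones k)

sum-+-ones : (f : Fin k → ℕ) → sum (λ i → suc (f i)) ≡ sum f + k
sum-+-ones {k} f = begin
  sum (λ i → suc (f i))       ≡⟨ sum-cong-≗ (λ i → +-comm 1 (f i)) ⟩
  sum (λ i → f i + 1)         ≡⟨ ∑-distrib-+ f (λ _ → 1) ⟩
  sum f + sum {k} (λ _ → 1)   ≡⟨ cong (sum f +_) (sum-ones k) ⟩
  sum f + k                   ∎
  where open ≡-Reasoning

term≤sum : (f : Fin k → ℕ) (i : Fin k) → f i ≤ sum f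
term≤sum f fzero    = m≤m+n _ _
term≤sum f (fsuc i) = ≤-trans (term≤sum (f ∘ fsuc) i) (m≤n+m _ _)

sum-concentrated : (f : Fin k → ℕ) (i : Fin k) → (∀ l → l ≢ i → f l ≡ 0) → sum f ≡ f i
sum-concentrated {suc k} f fzero    off = begin
  f fzero + sum (f ∘ fsuc)       ≡⟨ cong (f fzero +_) (sum-cong-≗ (λ l → off (fsuc l) λ ())) ⟩
  f fzero + sum {k} (λ _ → 0)    ≡⟨ cong (f fzero +_) (sum-replicate-zero k) ⟩
  f fzero + 0                    ≡⟨ +-identityʳ _ ⟩
  f fzero                        ∎
  where open ≡-Reasoning
sum-concentrated {suc k} f (fsuc i) off =
  trans (cong (_+ sum (f ∘ fsuc)) (off fzero λ ()))
        (sum-concentrated (f ∘ fsuc) i (λ l l≢i → off (fsuc l) (l≢i ∘ Finₚ.suc-injective)))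

sum-positive : (f : Fin k → ℕ) → 0 < sum f → ∃ λ v → 0 < f v
sum-positive {suc k} f pos with f fzero in eq
... | suc _ = fzero , subst (0 <_) (≡.sym eq) (s≤s z≤n)
... | zero  = let v , fv>0 = sum-positive (f ∘ fsuc) pos in fsuc v , fv>0

single : Fin k → ℕ → Fin k → ℕ
single v x w with w ≟ v
... | yes _ = x
... | no  _ = 0

single-≡ : (v : Fin k) (x : ℕ) → single v x v ≡ x
single-≡ v x with v ≟ v
... | yes _   = refl
... | no  v≢v = contradiction refl v≢v

single-≢ : {v w : Fin k} (x : ℕ) → w ≢ v → single v x w ≡ 0
single-≢ {v = v} {w} x w≢v with w ≟ v
... | yes w≡v = contradiction w≡v w≢v
... | no  _   = refl

single≤ : (v w : Fin k) (x : ℕ) → single v x w ≤ x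
single≤ v w x with w ≟ v
... | yes _ = ≤-refl
... | no  _ = z≤n

sum-single : (v : Fin k) (x : ℕ) → sum (single v x) ≡ x
sum-single v x = trans (sum-concentrated (single v x) v (λ _ → single-≢ x)) (single-≡ v x)

sum-+-single : (f : Fin k → ℕ) (v : Fin k) (x : ℕ) → sum (λ i → f i + single v x i) ≡ sum f + x
sum-+-single f v x = trans (∑-distrib-+ f (single v x)) (cong (sum f +_) (sum-single v x))

sum-∸-single : (f : Fin k → ℕ) (v : Fin k) → sum f ≤ suc (sum (λ i → f i ∸ single v 1 i))
sum-∸-single f v = begin
  sum f                                                  ≤⟨ sum-mono-≤ (λ i → m≤n+m∸n (f i) (single v 1 i)) ⟩
  sum (λ i → single v 1 i + (f i ∸ single v 1 i))        ≡⟨ ∑-distrib-+ (single v 1) _ ⟩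
  sum (single v 1) + sum (λ i → f i ∸ single v 1 i)      ≡⟨ cong (_+ sum (λ i → f i ∸ single v 1 i)) (sum-single v 1) ⟩
  suc (sum (λ i → f i ∸ single v 1 i))                   ∎
  where open ≤-Reasoning

module _ {P : ℕ → Set} (P? : Decidable P) where

  lastBelow : ℕ → ℕ
  lastBelow zero    = 0
  lastBelow (suc b) with P? (suc b)
  ... | yes _ = suc b
  ... | no  _ = lastBelow b

  lastBelow-≤ : ∀ b → lastBelow b ≤ b
  lastBelow-≤ zero    = z≤n
  lastBelow-≤ (suc b) with P? (suc b)
  ... | yes _ = ≤-refl
  ... | no  _ = m≤n⇒m≤1+n (lastBelow-≤ b)

  lastBelow-satisfies : ∀ b → 1 ≤ lastBelow b → P (lastBelow b)
  lastBelow-satisfies (suc b) 1≤ with P? (suc b)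
  ... | yes Pb = Pb
  ... | no  _  = lastBelow-satisfies b 1≤

  lastBelow-last : ∀ b → lastBelow b < b → ¬ P (suc (lastBelow b))
  lastBelow-last (suc b) lb<b with P? (suc b)
  ... | yes _  = contradiction lb<b (<-irrefl refl)
  ... | no ¬Pb with m≤n⇒m<n∨m≡n (lastBelow-≤ b)
  ...   | inj₁ <b = lastBelow-last b <b
  ...   | inj₂ ≡b = subst (λ s → ¬ P (suc s)) (≡.sym ≡b) ¬Pb

ArgMax : (ℕ → ℕ) → ℕ → Set
ArgMax h hi = ∃ λ a → 1 ≤ a × a ≤ hi × (∀ a' → 1 ≤ a' → a' ≤ hi → h a' ≤ h a)

argmax : (h : ℕ → ℕ) (hi : ℕ) → 1 ≤ hi → ArgMax h hi
argmax h (suc zero) _ = 1 , ≤-refl , ≤-refl , λ a' 1≤a' a'≤1 → ≤-reflexive (cong h (≤-antisym a'≤1 1≤a'))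
argmax h (suc (suc b)) _ with argmax h (suc b) (s≤s z≤n)
... | a , 1≤a , a≤ , max with h (suc (suc b)) ≤? h a
...   | yes top≤ = a , 1≤a , m≤n⇒m≤1+n a≤ , λ a' 1≤a' a'≤ → by-cases a' 1≤a' (m≤n⇒m<n∨m≡n a'≤)
  where
  by-cases : ∀ a' → 1 ≤ a' → a' < suc (suc b) ⊎ a' ≡ suc (suc b) → h a' ≤ h a
  by-cases a' 1≤a' (inj₁ a'<) = max a' 1≤a' (m<1+n⇒m≤n a'<)
  by-cases _  _    (inj₂ refl) = top≤
...   | no top≰ = suc (suc b) , s≤s z≤n , ≤-refl , λ a' 1≤a' a'≤ → by-cases a' 1≤a' (m≤n⇒m<n∨m≡n a'≤)
  where
  by-cases : ∀ a' → 1 ≤ a' → a' < suc (suc b) ⊎ a' ≡ suc (suc b) → h a' ≤ h (suc (suc b))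
  by-cases a' 1≤a' (inj₁ a'<) = ≤-trans (max a' 1≤a' (m<1+n⇒m≤n a'<)) (<⇒≤ (≰⇒> top≰))
  by-cases _  _    (inj₂ refl) = ≤-refl

IsComposition : ℕ → (Fin k → ℕ) → Set
IsComposition N ts = (∀ i → 1 ≤ ts i) × sum ts ≡ N

composition⇒admissible : ∀ {t j} (ts : Fin j → ℕ) → IsComposition (t + j ∸ 1) ts → Admissible t j ts
composition⇒admissible ts (1≤ts , Σts) = 1≤ts , trans (sumFin≡sum ts) Σts

admissible⇒composition : ∀ {t j} (ts : Fin j → ℕ) → Admissible t j ts → IsComposition (t + j ∸ 1) ts
admissible⇒composition ts (1≤ts , Σts) = 1≤ts , trans (≡.sym (sumFin≡sum ts)) Σts

composition-length : ∀ {N} (ts : Fin k → ℕ) → IsComposition N ts → k ≤ N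
composition-length {k} ts (1≤ts , Σts) = subst₂ _≤_ (sum-ones k) Σts (sum-mono-≤ 1≤ts)

-- The tuple is a composition of N only when N ≥ k + 1; the maximality holds regardless,
-- which lets the recursion choose the first part before knowing the rest is feasible.
MaximalComposition : ∀ k → (ℕ → Fin (suc k) → ℕ) → ℕ → Set
MaximalComposition k g N = ∃ λ ts → (suc k ≤ N → IsComposition N ts) ×
                           (∀ ts' → IsComposition N ts' → sum (λ i → g (ts' i) i) ≤ sum (λ i → g (ts i) i))

maximal-composition : ∀ k (g : ℕ → Fin (suc k) → ℕ) N → MaximalComposition k g N
maximal-composition zero g N = (λ _ → N) , (λ 1≤N → (λ _ → 1≤N) , +-identityʳ N) , λ ts' (_ , Σts') →
  ≤-reflexive (cong (λ a → g a fzero + 0) (trans (≡.sym (+-identityʳ _)) Σts'))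
maximal-composition (suc k) g N with suc (suc k) ≤? N
... | no  N< = (λ _ → 1) , (λ N≥ → contradiction N≥ N<) , λ ts' comp → contradiction (composition-length ts' comp) N<
... | yes N≥ = ts , (λ _ → composition) , maximal
  where
  tail-of : ∀ a → MaximalComposition k (λ s i → g s (fsuc i)) (N ∸ a)
  tail-of a = maximal-composition k (λ s i → g s (fsuc i)) (N ∸ a)
  tail-best : ℕ → Fin (suc k) → ℕ
  tail-best a = proj₁ (tail-of a)
  h : ℕ → ℕ
  h a = g a fzero + sum (λ i → g (tail-best a i) (fsuc i))
  best : ArgMax h (N ∸ suc k)
  best = argmax h (N ∸ suc k) (m+n≤o⇒m≤o∸n 1 N≥)
  a : ℕ
  a = proj₁ best
  a≤ : a ≤ N ∸ suc k
  a≤ = proj₁ (proj₂ (proj₂ best))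
  fits : ∀ {a'} → a' ≤ N ∸ suc k → suc k ≤ N ∸ a'
  fits {a'} a'≤ = m+n≤o⇒m≤o∸n (suc k) (subst (_≤ N) (+-comm a' (suc k)) (m≤o∸n⇒m+n≤o a' (<⇒≤ N≥) a'≤))
  ts : Fin (suc (suc k)) → ℕ
  ts = a ∷ tail-best a
  composition : IsComposition N ts
  composition = (λ { fzero → proj₁ (proj₂ best) ; (fsuc i) → proj₁ (proj₁ (proj₂ (tail-of a)) (fits a≤)) i })
              , trans (cong (a +_) (proj₂ (proj₁ (proj₂ (tail-of a)) (fits a≤))))
                      (m+[n∸m]≡n (≤-trans a≤ (m∸n≤m N (suc k))))
  maximal : ∀ ts' → IsComposition N ts' → sum (λ i → g (ts' i) i) ≤ sum (λ i → g (ts i) i)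
  maximal ts' (1≤ts' , Σts') = begin
    g a' fzero + sum (λ i → g (tail' i) (fsuc i))
      ≤⟨ +-monoʳ-≤ (g a' fzero) (proj₂ (proj₂ (tail-of a')) tail' (1≤ts' ∘ fsuc , Σtail')) ⟩
    h a'
      ≤⟨ proj₂ (proj₂ (proj₂ best)) a' (1≤ts' fzero) a'≤ ⟩
    h a
      ∎
    where
    open ≤-Reasoning
    a' : ℕ
    a' = ts' fzero
    tail' : Fin (suc k) → ℕ
    tail' = ts' ∘ fsuc
    Σtail' : sum tail' ≡ N ∸ a'
    Σtail' = trans (≡.sym (m+n∸m≡n a' _)) (cong (_∸ a') Σts')
    a'≤ : a' ≤ N ∸ suc k
    a'≤ = m+n≤o⇒m≤o∸n a' (subst (a' + suc k ≤_) Σts' (+-monoʳ-≤ a' (composition-length tail' (1≤ts' ∘ fsuc , refl))))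

¬¬-shift-Fin : ∀ k (Q : Fin k → Set) → (∀ i → ¬ ¬ Q i) → ¬ ¬ (∀ i → Q i)
¬¬-shift-Fin zero    Q ¬¬Q ¬all = ¬all λ ()
¬¬-shift-Fin (suc k) Q ¬¬Q ¬all =
  ¬¬Q fzero λ Q₀ → ¬¬-shift-Fin k (Q ∘ fsuc) (¬¬Q ∘ fsuc) λ Qₛ → ¬all λ { fzero → Q₀ ; (fsuc i) → Qₛ i }

¬¬-shift-≤ : ∀ m (Q : ℕ → Set) → (∀ a → a ≤ m → ¬ ¬ Q a) → ¬ ¬ (∀ a → a ≤ m → Q a)
¬¬-shift-≤ m Q ¬¬Q = ¬¬-map (λ all a a≤m → subst Q (Finₚ.toℕ-fromℕ< (s≤s a≤m)) (all (fromℕ< (s≤s a≤m))))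
                            (¬¬-shift-Fin (suc m) (Q ∘ toℕ) (λ i → ¬¬Q (toℕ i) (Finₚ.toℕ≤pred[n] i)))

Bounded : ℕ → Config n → Set
Bounded m C = ∀ w → C w ≤ m

-- Values bounded by m make the quantifier over configurations a finite one.
¬¬-shift-Bounded : ∀ n m (Q : Config n → Set) → (∀ {C C'} → C ≗ C' → Q C → Q C') →
                   (∀ C → Bounded m C → ¬ ¬ Q C) → ¬ ¬ (∀ C → Bounded m C → Q C)
¬¬-shift-Bounded zero    m Q resp ¬¬Q ¬all = ¬¬Q (λ ()) (λ ()) λ Q₀ → ¬all λ C _ → resp (λ ()) Q₀
¬¬-shift-Bounded (suc n) m Q resp ¬¬Q =
  ¬¬-map (λ all C C≤m → resp (λ { fzero → refl ; (fsuc w) → refl }) (all (head C) (C≤m fzero) (tail C) (C≤m ∘ fsuc)))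
    (¬¬-shift-≤ m (λ a → ∀ C → Bounded m C → Q (a ∷ C))
      (λ a a≤m → ¬¬-shift-Bounded n m (λ C → Q (a ∷ C))
                   (λ C≗C' → resp λ { fzero → refl ; (fsuc w) → C≗C' w })
                   (λ C C≤m → ¬¬Q (a ∷ C) λ { fzero → a≤m ; (fsuc w) → C≤m w })))

infixl 6 _⊕_
infix  4 _≼_

_⊕_ : Config n → Config n → Config n
(C ⊕ D) w = C w + D w

_≼_ : Config n → Config n → Set
C ≼ D = ∀ w → C w ≤ D w

move-source : (u v : Fin n) (X : Config n) → move u v X u ≡ X u ∸ 2
move-source u v X with u ≟ u
... | yes _   = refl
... | no  u≢u = contradiction refl u≢u

move-target : {u v : Fin n} (X : Config n) → u ≢ v → move u v X v ≡ suc (X v)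
move-target {u = u} {v} X u≢v with v ≟ u | v ≟ v
... | yes v≡u | _       = contradiction (≡.sym v≡u) u≢v
... | no _    | yes _   = refl
... | no _    | no  v≢v = contradiction refl v≢v

move-other : {u v w : Fin n} (X : Config n) → w ≢ u → w ≢ v → move u v X w ≡ X w
move-other {u = u} {v} {w} X w≢u w≢v with w ≟ u | w ≟ v
... | yes w≡u | _       = contradiction w≡u w≢u
... | no _    | yes w≡v = contradiction w≡v w≢v
... | no _    | no _    = refl

move-cong-at : (u v w : Fin n) {X Y : Config n} → X u ≡ Y u → X w ≡ Y w → move u v X w ≡ move u v Y w
move-cong-at u v w Xu≡Yu Xw≡Yw with w ≟ u | w ≟ v
... | yes refl | _        = cong (_∸ 2) Xu≡Yu
... | no _     | yes refl = cong suc Xw≡Yw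
... | no _     | no _     = Xw≡Yw

move-≤-single : (u v w : Fin n) (X : Config n) → w ≢ u → move u v X w ≤ X w + single v 1 w
move-≤-single u v w X w≢u = by-cases (w ≟ v)
  where
  by-cases : Dec (w ≡ v) → move u v X w ≤ X w + single v 1 w
  by-cases (yes refl) = ≤-reflexive (begin
    move u w X w         ≡⟨ move-target X (w≢u ∘ ≡.sym) ⟩
    suc (X w)            ≡⟨ +-comm 1 (X w) ⟩
    X w + 1              ≡⟨ cong (X w +_) (≡.sym (single-≡ w 1)) ⟩
    X w + single w 1 w   ∎)
    where open ≡-Reasoning
  by-cases (no w≢v) = ≤-trans (≤-reflexive (move-other X w≢u w≢v)) (m≤m+n _ _)

move-⊕-≼ : (u v : Fin n) (C D X : Config n) → 2 ≤ C u → C ⊕ D ≼ X →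
           move u v C ⊕ D ≼ move u v X
move-⊕-≼ u v C D X 2≤Cu C⊕D≼X w with w ≟ u | w ≟ v
... | yes refl | _        = subst (_≤ X w ∸ 2) (+-∸-comm (D w) 2≤Cu) (∸-monoˡ-≤ 2 (C⊕D≼X w))
... | no _     | yes refl = s≤s (C⊕D≼X w)
... | no _     | no _     = C⊕D≼X w

move-keeps-deficit : (u v₀ v : Fin n) (C X : Config n) → 2 ≤ X u → C ≼ X ⊕ single v 1 →
                     move u v₀ C ≼ move u v₀ X ⊕ single v 1
move-keeps-deficit u v₀ v C X 2≤Xu C≼X+1 w with w ≟ u | w ≟ v₀
... | yes refl | _        = subst (C w ∸ 2 ≤_) (+-∸-comm (single v 1 w) 2≤Xu) (∸-monoˡ-≤ 2 (C≼X+1 w))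
... | no _     | yes refl = s≤s (C≼X+1 w)
... | no _     | no _     = C≼X+1 w

deficit-elsewhere : {u w : Fin n} (C X : Config n) → C ≼ X ⊕ single u 1 → w ≢ u → C w ≤ X w
deficit-elsewhere {w = w} C X C≼X+1 w≢u =
  subst (C w ≤_) (trans (cong (X w +_) (single-≢ 1 w≢u)) (+-identityʳ _)) (C≼X+1 w)

move-shifts-deficit : (u v₀ : Fin n) (C X : Config n) → C ≼ X ⊕ single u 1 →
                      move u v₀ C ≼ X ⊕ single v₀ 1
move-shifts-deficit u v₀ C X C≼X+1 w with w ≟ u | w ≟ v₀
... | yes refl | _        = ≤-trans (∸2≤ (C w) (X w) (subst (λ d → C w ≤ X w + d) (single-≡ w 1) (C≼X+1 w)))
                                    (m≤m+n _ _)
  where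
  ∸2≤ : ∀ c x → c ≤ x + 1 → c ∸ 2 ≤ x
  ∸2≤ c x c≤x+1 = subst (c ∸ 2 ≤_) (m+n∸n≡m x 1) (≤-trans (∸-monoʳ-≤ c (n≤1+n 1)) (∸-monoˡ-≤ 1 c≤x+1))
... | no w≢u   | yes refl = subst (suc (C w) ≤_) (+-comm 1 (X w)) (s≤s (deficit-elsewhere C X C≼X+1 w≢u))
... | no w≢u   | no _     = ≤-trans (deficit-elsewhere C X C≼X+1 w≢u) (m≤m+n _ _)

module Pebbling {n} (G : Graph n) (S : Fin n → Set) (r : Fin n) where

  Steps : Config n → Config n → Set
  Steps = Star (Step G S)

  steps-frame : ∀ {C C'} (D X : Config n) → Steps C C' → C ⊕ D ≼ X →
                ∃ λ X' → Steps X X' × C' ⊕ D ≼ X'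
  steps-frame D X ε C⊕D≼X = X , ε , C⊕D≼X
  steps-frame {C} D X (_◅_ {j = C₁} (u , v , Su , Sv , uv , 2≤Cu , C₁≗) rest) C⊕D≼X =
    let X' , X↝X' , C'⊕D≼X' = steps-frame D (move u v X) rest C₁⊕D≼
    in X' , (u , v , Su , Sv , uv , 2≤Xu , λ _ → refl) ◅ X↝X' , C'⊕D≼X'
    where
    2≤Xu : 2 ≤ X u
    2≤Xu = ≤-trans 2≤Cu (≤-trans (m≤m+n _ _) (C⊕D≼X u))
    C₁⊕D≼ : C₁ ⊕ D ≼ move u v X
    C₁⊕D≼ w rewrite C₁≗ w = move-⊕-≼ u v C D X 2≤Cu C⊕D≼X w

  -- A configuration short of C by one pebble can follow C's moves, except the
  -- moves of the missing pebble, which it skips.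
  steps-deficit : ∀ {C C'} (X : Config n) v → Steps C C' → C ≼ X ⊕ single v 1 →
                  ∃₂ λ X' v' → Steps X X' × C' ≼ X' ⊕ single v' 1
  steps-deficit X v ε C≼X+1 = X , v , ε , C≼X+1
  steps-deficit {C} X v (_◅_ {j = C₁} (u , v₀ , Su , Sv₀ , uv₀ , 2≤Cu , C₁≗) rest) C≼X+1 with 2 ≤? X u
  ... | yes 2≤Xu =
    let X' , v' , X↝X' , C'≼ = steps-deficit (move u v₀ X) v rest
                                 (λ w → subst (_≤ _) (≡.sym (C₁≗ w)) (move-keeps-deficit u v₀ v C X 2≤Xu C≼X+1 w))
    in X' , v' , (u , v₀ , Su , Sv₀ , uv₀ , 2≤Xu , λ _ → refl) ◅ X↝X' , C'≼
  ... | no 2≰Xu = steps-deficit X v₀ rest C₁≼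
    where
    u≡v : u ≡ v
    u≡v with u ≟ v
    ... | yes u≡v = u≡v
    ... | no  u≢v = contradiction (≤-trans 2≤Cu (deficit-elsewhere C X C≼X+1 u≢v)) 2≰Xu
    C₁≼ : C₁ ≼ X ⊕ single v₀ 1
    C₁≼ w rewrite C₁≗ w | u≡v = move-shifts-deficit v v₀ C X C≼X+1 w

  Solves : ℕ → Config n → Set
  Solves = Solvable G S r

  solves-≤ : ∀ {a b C} → a ≤ b → Solves b C → Solves a C
  solves-≤ a≤b (C' , C↝C' , b≤) = C' , C↝C' , ≤-trans a≤b b≤

  solves-frame : ∀ {k C} (D X : Config n) → Solves k C → C ⊕ D ≼ X → Solves (k + D r) X
  solves-frame D X (C' , C↝C' , k≤) C⊕D≼X =
    let X' , X↝X' , C'⊕D≼X' = steps-frame D X C↝C' C⊕D≼X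
    in X' , X↝X' , ≤-trans (+-monoˡ-≤ (D r) k≤) (C'⊕D≼X' r)

  solves-mono : ∀ {k C} (X : Config n) → Solves k C → C ≼ X → Solves k X
  solves-mono {k} X sol C≼X =
    subst (λ a → Solves a X) (+-identityʳ k)
          (solves-frame (λ _ → 0) X sol (λ w → subst (_≤ X w) (≡.sym (+-identityʳ _)) (C≼X w)))

  solves-deficit : ∀ {k C} (X : Config n) v → Solves k C → C ≼ X ⊕ single v 1 → Solves (k ∸ 1) X
  solves-deficit {k} X v (C' , C↝C' , k≤) C≼X+1 =
    let X' , v' , X↝X' , C'≼ = steps-deficit X v C↝C' C≼X+1
        k≤X'r+1 = ≤-trans k≤ (≤-trans (C'≼ r) (+-monoʳ-≤ (X' r) (single≤ v' r 1)))
    in X' , X↝X' , subst (k ∸ 1 ≤_) (m+n∸n≡m (X' r) 1) (∸-monoˡ-≤ 1 k≤X'r+1)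

  solves-⊕ : ∀ {a b} (X Y : Config n) → Solves a X → Solves b Y → Solves (a + b) (X ⊕ Y)
  solves-⊕ {a} {b} X Y (X' , X↝X' , a≤) solY =
    let Z , X⊕Y↝Z , X'⊕Y≼Z = steps-frame Y (X ⊕ Y) X↝X' (λ w → ≤-refl)
        W , Z↝W , b+X'r≤ = solves-frame X' Z solY (λ w → subst (_≤ Z w) (+-comm (X' w) (Y w)) (X'⊕Y≼Z w))
    in W , X⊕Y↝Z ◅◅ Z↝W , ≤-trans (subst (_≤ b + X' r) (+-comm b a) (+-monoʳ-≤ b a≤)) b+X'r≤

  solves-∑ : ∀ {k} (Cs : Fin k → Config n) (as : Fin k → ℕ) → (∀ i → Solves (as i) (Cs i)) →
             Solves (sum as) (λ w → sum (λ i → Cs i w))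
  solves-∑ {zero}  Cs as sol = (λ _ → 0) , ε , z≤n
  solves-∑ {suc k} Cs as sol =
    solves-⊕ (Cs fzero) (λ w → sum (λ i → Cs (fsuc i) w)) (sol fzero) (solves-∑ (Cs ∘ fsuc) (as ∘ fsuc) (sol ∘ fsuc))

  solves-empty : ∀ {k} → Solves k (λ _ → 0) → k ≡ 0
  solves-empty (C' , ε , k≤0) = n≤0⇒n≡0 k≤0
  solves-empty (C' , (u , _ , _ , _ , _ , 2≤0 , _) ◅ _ , _) with 2≤0
  ... | ()

  solves-in-G : ∀ {k C} → Solves k C → Solvable G Whole r k C
  solves-in-G (C' , C↝C' , k≤) = C' , Star.map (λ (u , v , _ , _ , uv , 2≤ , eq) → u , v , tt , tt , uv , 2≤ , eq) C↝C' , k≤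

  allSolvable-suc : ∀ {k m} → AllSolvable G S r k m → AllSolvable G S r k (suc m)
  allSolvable-suc {k} {m} all C supp size≡ = solves-mono C (all C⁻ supp⁻ size⁻) (λ w → m∸n≤m (C w) (single v 1 w))
    where
    occupied : ∃ λ v → 0 < C v
    occupied = sum-positive C (subst (0 <_) (trans (≡.sym size≡) (sumFin≡sum C)) (s≤s z≤n))
    v : Fin n
    v = proj₁ occupied
    0<Cv : 0 < C v
    0<Cv = proj₂ occupied
    C⁻ : Config n
    C⁻ w = C w ∸ single v 1 w
    supp⁻ : Supported S C⁻
    supp⁻ w ¬Sw = subst (λ c → c ∸ single v 1 w ≡ 0) (≡.sym (supp w ¬Sw)) (0∸n≡0 (single v 1 w))
    restore : ∀ w → C⁻ w + single v 1 w ≡ C w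
    restore w with w ≟ v
    ... | yes refl = m∸n+n≡m 0<Cv
    ... | no  _    = +-identityʳ (C w)
    size⁻ : sumFin C⁻ ≡ m
    size⁻ = suc-injective (begin
      suc (sumFin C⁻)                ≡⟨ +-comm 1 _ ⟩
      sumFin C⁻ + 1                  ≡⟨ cong₂ _+_ (sumFin≡sum C⁻) (≡.sym (sum-single v 1)) ⟩
      sum C⁻ + sum (single v 1)      ≡⟨ ≡.sym (∑-distrib-+ C⁻ (single v 1)) ⟩
      sum (C⁻ ⊕ single v 1)          ≡⟨ sum-cong-≗ restore ⟩
      sum C                          ≡⟨ trans (≡.sym (sumFin≡sum C)) size≡ ⟩
      suc m                          ∎)
      where open ≡-Reasoning

  allSolvable-mono : ∀ {k m m'} → m ≤ m' → AllSolvable G S r k m → AllSolvable G S r k m'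
  allSolvable-mono {k} {m} m≤m' all = subst (AllSolvable G S r k) (m∸n+n≡m m≤m') (plus _)
    where
    plus : ∀ d → AllSolvable G S r k (d + m)
    plus zero    = all
    plus (suc d) = allSolvable-suc (plus d)

  ¬allSolvable-0 : ∀ {k} → 1 ≤ k → ¬ AllSolvable G S r k 0
  ¬allSolvable-0 1≤k all = m<n⇒n≢0 1≤k (solves-empty (all (λ _ → 0) (λ _ _ → refl) empty-size))
    where
    empty-size : sumFin {n} (λ _ → 0) ≡ 0
    empty-size = trans (sumFin≡sum {n} (λ _ → 0)) (sum-replicate-zero n)

  ¬allSolvable⇒¬¬unsolvable : ∀ {k m} → ¬ AllSolvable G S r k m →
                              ¬ ¬ (∃ λ C → Supported S C × sumFin C ≡ m × ¬ Solves k C)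
  ¬allSolvable⇒¬¬unsolvable {k} {m} ¬all ¬unsolvable =
    ¬¬-shift-Bounded n m Q resp ¬¬Q λ all → ¬all λ C supp size≡ → all C (bounded C size≡) supp size≡
    where
    Q : Config n → Set
    Q C = Supported S C → sumFin C ≡ m → Solves k C
    resp : ∀ {C C'} → C ≗ C' → Q C → Q C'
    resp {C} {C'} C≗C' QC supp size≡ =
      solves-mono C' (QC (λ w ¬Sw → trans (C≗C' w) (supp w ¬Sw))
                         (trans (sumFin≡sum C) (trans (sum-cong-≗ C≗C') (trans (≡.sym (sumFin≡sum C')) size≡))))
                     (≤-reflexive ∘ C≗C')
    ¬¬Q : ∀ C → Bounded m C → ¬ ¬ Q C
    ¬¬Q C _ ¬QC = ¬QC λ supp size≡ → ⊥-elim (¬unsolvable (C , supp , size≡ , λ sol → ¬QC λ _ _ → sol))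
    bounded : ∀ C → sumFin C ≡ m → Bounded m C
    bounded C size≡ w = ≤-trans (term≤sum C w) (≤-reflexive (trans (≡.sym (sumFin≡sum C)) size≡))

module PebblingNumber {n} (G : Graph n) (S : Fin n → Set) (r : Fin n) (r∈S : S r)
  (π : ℕ → ℕ) (isπ : ∀ t → 1 ≤ t → IsPebblingNumber G S r t (π t)) where
  open Pebbling G S r

  π-positive : ∀ {t} → 1 ≤ t → 1 ≤ π t
  π-positive {t} 1≤t with π t in π≡
  ... | suc _ = s≤s z≤n
  ... | zero  = contradiction (subst (AllSolvable G S r t) π≡ (proj₁ (isπ t 1≤t))) (¬allSolvable-0 1≤t)

  -- One pebble fewer than π (t + 1) is still t-fold solvable: add a pebble at r and give it back.
  π-strict : ∀ {t} → 1 ≤ t → π t < π (suc t)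
  π-strict {t} 1≤t with π t <? π (suc t)
  ... | yes π<π = π<π
  ... | no  π≮π = contradiction allSolvable-π⁻ (proj₂ (isπ t 1≤t) (π (suc t) ∸ 1) π⁻<π)
    where
    π⁺ : ℕ
    π⁺ = π (suc t)
    1≤π⁺ : 1 ≤ π⁺
    1≤π⁺ = π-positive (s≤s z≤n)
    π⁻<π : π⁺ ∸ 1 < π t
    π⁻<π = <-≤-trans (subst (π⁺ ∸ 1 <_) (trans (+-comm 1 _) (m∸n+n≡m 1≤π⁺)) (n<1+n _)) (≮⇒≥ π≮π)
    allSolvable-π⁻ : AllSolvable G S r t (π⁺ ∸ 1)
    allSolvable-π⁻ C supp size≡ = solves-deficit C r (proj₁ (isπ (suc t) (s≤s z≤n)) (C ⊕ single r 1) supp⁺ size⁺)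
                                    (λ w → ≤-refl)
      where
      supp⁺ : Supported S (C ⊕ single r 1)
      supp⁺ w ¬Sw = cong₂ _+_ (supp w ¬Sw) (single-≢ 1 (λ w≡r → ¬Sw (subst S (≡.sym w≡r) r∈S)))
      size⁺ : sumFin (C ⊕ single r 1) ≡ π⁺
      size⁺ = begin
        sumFin (C ⊕ single r 1)       ≡⟨ sumFin≡sum (C ⊕ single r 1) ⟩
        sum (C ⊕ single r 1)          ≡⟨ ∑-distrib-+ C (single r 1) ⟩
        sum C + sum (single r 1)      ≡⟨ cong₂ _+_ (trans (≡.sym (sumFin≡sum C)) size≡) (sum-single r 1) ⟩
        (π⁺ ∸ 1) + 1                  ≡⟨ m∸n+n≡m 1≤π⁺ ⟩
        π⁺                            ∎
        where open ≡-Reasoning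

  π-+ : ∀ {t} e → 1 ≤ t → π t + e ≤ π (t + e)
  π-+ {t} zero    1≤t rewrite +-identityʳ t | +-identityʳ (π t) = ≤-refl
  π-+ {t} (suc e) 1≤t rewrite +-suc (π t) e | +-suc t e =
    ≤-trans (s≤s (π-+ e 1≤t)) (π-strict (≤-trans 1≤t (m≤m+n t e)))

module Decomposition {n} (G : Graph n) (r : Fin n) (Er : Fin n → Fin n → Set)
  (Er⊆ : ∀ u v → Er u v → Adj G u v × Adj G r u × Adj G r v)
  (j : ℕ) (comp : Fin n → Fin j) (labelling : IsComponentLabelling G r Er j comp) where

  Piece : Fin j → Fin n → Set
  Piece = PieceSet r comp

  InComponent : Fin j → Fin n → Set
  InComponent i w = w ≢ r × comp w ≡ i

  restrict : Fin j → Config n → Config n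
  restrict i C w with w ≟ r
  ... | yes _ = 0
  ... | no _ with comp w ≟ i
  ...   | yes _ = C w
  ...   | no _  = 0

  restrict-in : ∀ {i w} C → InComponent i w → restrict i C w ≡ C w
  restrict-in {i} {w} C (w≢r , comp≡) with w ≟ r
  ... | yes w≡r = contradiction w≡r w≢r
  ... | no _ with comp w ≟ i
  ...   | yes _    = refl
  ...   | no comp≢ = contradiction comp≡ comp≢

  restrict-out : ∀ {i w} C → ¬ InComponent i w → restrict i C w ≡ 0
  restrict-out {i} {w} C ¬in with w ≟ r
  ... | yes _ = refl
  ... | no w≢r with comp w ≟ i
  ...   | yes comp≡ = contradiction (w≢r , comp≡) ¬in
  ...   | no _      = refl

  restrict-root : ∀ {i} C → restrict i C r ≡ 0
  restrict-root C = restrict-out C λ (r≢r , _) → r≢r refl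

  restrict-supported : ∀ i C → Supported (Piece i) (restrict i C)
  restrict-supported i C w ¬piece = restrict-out C λ w∈ → ¬piece (inj₂ w∈)

  restrict-⊕-single-≼ : ∀ {i} (C X : Config n) d → d ≤ X r → (∀ w → InComponent i w → C w ≤ X w) →
                        restrict i C ⊕ single r d ≼ X
  restrict-⊕-single-≼ {i} C X d d≤Xr C≤X w = by-cases (w ≟ r) (comp w ≟ i)
    where
    by-cases : Dec (w ≡ r) → Dec (comp w ≡ i) → restrict i C w + single r d w ≤ X w
    by-cases (yes refl) _ = subst (_≤ X w) (cong₂ _+_ (≡.sym (restrict-root C)) (≡.sym (single-≡ w d))) d≤Xr
    by-cases (no w≢r) (yes comp≡) =
      subst (_≤ X w) (cong₂ _+_ (≡.sym (restrict-in C (w≢r , comp≡))) (≡.sym (single-≢ d w≢r)))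
            (subst (_≤ X w) (≡.sym (+-identityʳ (C w))) (C≤X w (w≢r , comp≡)))
    by-cases (no w≢r) (no comp≢) =
      subst (_≤ X w) (cong₂ _+_ (≡.sym (restrict-out C λ (_ , comp≡) → comp≢ comp≡)) (≡.sym (single-≢ d w≢r))) z≤n

  restrict-≼ : ∀ {i} (C X : Config n) → (∀ w → InComponent i w → C w ≤ X w) → restrict i C ≼ X
  restrict-≼ C X C≤X w = ≤-trans (m≤m+n _ _) (restrict-⊕-single-≼ C X 0 z≤n C≤X w)

  decompose : ∀ (C : Config n) → C ≗ single r (C r) ⊕ (λ w → sum (λ i → restrict i C w))
  decompose C w = by-cases (w ≟ r)
    where
    by-cases : Dec (w ≡ r) → C w ≡ single r (C r) w + sum (λ i → restrict i C w)
    by-cases (yes refl) = ≡.sym (trans (cong₂ _+_ (single-≡ w (C w))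
                                                  (trans (sum-cong-≗ {j} (λ i → restrict-root C)) (sum-replicate-zero j)))
                                       (+-identityʳ (C w)))
    by-cases (no w≢r) = ≡.sym (cong₂ _+_ (single-≢ (C r) w≢r)
                                         (trans (sum-concentrated (λ i → restrict i C w) (comp w) off)
                                                (restrict-in C (w≢r , refl))))
      where
      off : ∀ i → i ≢ comp w → restrict i C w ≡ 0
      off i i≢ = restrict-out C λ (_ , comp≡) → i≢ (≡.sym comp≡)

  size-decompose : (C : Config n) → sum C ≡ C r + sum (λ i → sum (restrict i C))
  size-decompose C = begin
    sum C                                                          ≡⟨ sum-cong-≗ (decompose C) ⟩
    sum (single r (C r) ⊕ (λ w → sum (λ i → restrict i C w)))      ≡⟨ ∑-distrib-+ (single r (C r)) _ ⟩
    sum (single r (C r)) + sum (λ w → sum (λ i → restrict i C w))  ≡⟨ cong₂ _+_ (sum-single r (C r))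
                                                                              (∑-comm (λ w i → restrict i C w)) ⟩
    C r + sum (λ i → sum (restrict i C))                           ∎
    where open ≡-Reasoning

  module InPiece (i : Fin j) = Pebbling G (Piece i) r

  other-component : ∀ {i w x} → InComponent i w → i ≢ comp x → w ≢ x
  other-component (_ , comp≡) i≢ w≡x = i≢ (trans (≡.sym comp≡) (cong comp w≡x))

  PiecewiseSolution : Config n → (Fin j → ℕ) → Set
  PiecewiseSolution C ks = ∀ i → InPiece.Solves i (ks i) (restrict i C)

  solves-restrict-mono : ∀ {i k} {C₁ : Config n} (C : Config n) → (∀ w → InComponent i w → C₁ w ≤ C w) →
                         InPiece.Solves i k (restrict i C₁) → InPiece.Solves i k (restrict i C)
  solves-restrict-mono {i} {C₁ = C₁} C C₁≤C sol =
    InPiece.solves-mono i (restrict i C) sol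
      (restrict-≼ C₁ (restrict i C) λ w w∈ → subst (C₁ w ≤_) (≡.sym (restrict-in C w∈)) (C₁≤C w w∈))

  solves-restrict-step : ∀ {i k u v} (C : Config n) → InComponent i u → Piece i v → Adj G u v → 2 ≤ C u →
                         InPiece.Solves i k (move u v (restrict i C)) → InPiece.Solves i k (restrict i C)
  solves-restrict-step C u∈ v∈ uv 2≤Cu (C' , X↝C' , k≤) =
    C' , (_ , _ , inj₂ u∈ , v∈ , uv , subst (2 ≤_) (≡.sym (restrict-in C u∈)) 2≤Cu , λ _ → refl) ◅ X↝C' , k≤

  restrict-move : ∀ {i u w} v (C : Config n) → InComponent i u → InComponent i w → move u v (restrict i C) w ≡ move u v C w
  restrict-move {u = u} {w} v C u∈ w∈ = move-cong-at u v w (restrict-in C u∈) (restrict-in C w∈)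

  piecewise-gain : ∀ {C₁ ks} (C : Config n) v → (∀ w → w ≢ r → C₁ w ≤ C w + single v 1 w) →
                  PiecewiseSolution C₁ ks → PiecewiseSolution C (λ i → ks i ∸ single (comp v) 1 i)
  piecewise-gain {C₁} {ks} C v C₁≤ sol i = by-cases (i ≟ comp v)
    where
    by-cases : Dec (i ≡ comp v) → InPiece.Solves i (ks i ∸ single (comp v) 1 i) (restrict i C)
    by-cases (yes refl) =
      subst (λ d → InPiece.Solves i (ks i ∸ d) (restrict i C)) (≡.sym (single-≡ i 1))
        (InPiece.solves-deficit i (restrict i C) v (sol i)
          (restrict-≼ C₁ _ λ w w∈ → subst (λ c → C₁ w ≤ c + single v 1 w) (≡.sym (restrict-in C w∈))
                                          (C₁≤ w (proj₁ w∈))))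
    by-cases (no i≢) =
      subst (λ d → InPiece.Solves i (ks i ∸ d) (restrict i C)) (≡.sym (single-≢ 1 i≢))
        (solves-restrict-mono C (λ w w∈ →
          subst (C₁ w ≤_) (trans (cong (C w +_) (single-≢ 1 (other-component w∈ i≢))) (+-identityʳ _))
                (C₁≤ w (proj₁ w∈))) (sol i))

  piecewise-send-root : ∀ {C₁ ks u} (C : Config n) → u ≢ r → Adj G u r → 2 ≤ C u →
                       (∀ w → w ≢ r → C₁ w ≤ move u r C w) →
                       PiecewiseSolution C₁ ks → PiecewiseSolution C (λ i → ks i + single (comp u) 1 i)
  piecewise-send-root {C₁} {ks} {u} C u≢r ur 2≤Cu C₁≤ sol i = by-cases (i ≟ comp u)
    where
    by-cases : Dec (i ≡ comp u) → InPiece.Solves i (ks i + single (comp u) 1 i) (restrict i C)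
    by-cases (yes refl) =
      subst (λ d → InPiece.Solves i (ks i + d) (restrict i C)) (trans (single-≡ r 1) (≡.sym (single-≡ i 1)))
        (solves-restrict-step C u∈ (inj₁ refl) ur 2≤Cu
          (InPiece.solves-frame i (single r 1) (move u r (restrict i C)) (sol i)
            (restrict-⊕-single-≼ C₁ _ 1 1≤ λ w w∈ →
              subst (C₁ w ≤_) (≡.sym (restrict-move r C u∈ w∈)) (C₁≤ w (proj₁ w∈)))))
      where
      u∈ : InComponent i u
      u∈ = u≢r , refl
      1≤ : 1 ≤ move u r (restrict i C) r
      1≤ = subst (1 ≤_) (≡.sym (move-target (restrict i C) u≢r)) (s≤s z≤n)
    by-cases (no i≢) =
      subst (λ d → InPiece.Solves i (ks i + d) (restrict i C)) (≡.sym (single-≢ 1 i≢))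
        (subst (λ k → InPiece.Solves i k (restrict i C)) (≡.sym (+-identityʳ (ks i)))
          (solves-restrict-mono C (λ w w∈ →
            ≤-trans (C₁≤ w (proj₁ w∈)) (≤-reflexive (move-other C (other-component w∈ i≢) (proj₁ w∈)))) (sol i)))

  piecewise-inner : ∀ {C₁ ks u v} (C : Config n) → u ≢ r → InComponent (comp u) v → Adj G u v → 2 ≤ C u →
                   (∀ w → w ≢ r → C₁ w ≤ move u v C w) → PiecewiseSolution C₁ ks → PiecewiseSolution C ks
  piecewise-inner {C₁} {ks} {u} {v} C u≢r v∈ uv 2≤Cu C₁≤ sol i = by-cases (i ≟ comp u)
    where
    u∈ : InComponent (comp u) u
    u∈ = u≢r , refl
    by-cases : Dec (i ≡ comp u) → InPiece.Solves i (ks i) (restrict i C)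
    by-cases (yes refl) =
      solves-restrict-step C u∈ (inj₂ v∈) uv 2≤Cu
        (InPiece.solves-mono i _ (sol i)
          (restrict-≼ C₁ _ λ w w∈ → subst (C₁ w ≤_) (≡.sym (restrict-move v C u∈ w∈)) (C₁≤ w (proj₁ w∈))))
    by-cases (no i≢) =
      solves-restrict-mono C (λ w w∈ →
        ≤-trans (C₁≤ w (proj₁ w∈))
                (≤-reflexive (move-other C (other-component w∈ i≢)
                                           (other-component w∈ λ i≡ → i≢ (trans i≡ (proj₂ v∈)))))) (sol i)

  cross-edge⇒¬¬adjacent-root : ∀ {u v} → u ≢ r → v ≢ r → Adj G u v → comp u ≢ comp v → ¬ ¬ Adj G u r
  cross-edge⇒¬¬adjacent-root {u} {v} u≢r v≢r uv comp≢ ¬ur =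
    comp≢ (proj₂ (proj₂ labelling u v u≢r v≢r) ((u≢r , v≢r , uv , ¬Er-uv , ¬Er-vu) ◅ ε))
    where
    ¬Er-uv : ¬ Er u v
    ¬Er-uv e = ¬ur (sym G (proj₁ (proj₂ (Er⊆ u v e))))
    ¬Er-vu : ¬ Er v u
    ¬Er-vu e = ¬ur (sym G (proj₂ (proj₂ (Er⊆ v u e))))

  Dominates : Config n → Config n → (Fin j → ℕ) → Set
  Dominates C C₁ ks₁ = ∃ λ ks → PiecewiseSolution C ks × C₁ r + sum ks₁ ≤ C r + sum ks

  dominates-from-root : ∀ {C C₁ ks₁ v} → v ≢ r → 2 ≤ C r → C₁ ≗ move r v C → PiecewiseSolution C₁ ks₁ → Dominates C C₁ ks₁
  dominates-from-root {C} {C₁} {ks₁} {v} v≢r 2≤Cr C₁≗ sol =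
    ks , piecewise-gain C v (λ w w≢r → subst (_≤ _) (≡.sym (C₁≗ w)) (move-≤-single r v w C w≢r)) sol , bound
    where
    ks : Fin j → ℕ
    ks i = ks₁ i ∸ single (comp v) 1 i
    bound : C₁ r + sum ks₁ ≤ C r + sum ks
    bound = begin
      C₁ r + sum ks₁         ≡⟨ cong (_+ sum ks₁) (trans (C₁≗ r) (move-source r v C)) ⟩
      C r ∸ 2 + sum ks₁      ≤⟨ +-monoʳ-≤ (C r ∸ 2) (sum-∸-single ks₁ (comp v)) ⟩
      C r ∸ 2 + suc (sum ks) ≡⟨ +-suc (C r ∸ 2) (sum ks) ⟩
      suc (C r ∸ 2) + sum ks ≤⟨ +-monoˡ-≤ (sum ks) 1+Cr∸2≤Cr ⟩
      C r + sum ks           ∎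
      where
      open ≤-Reasoning
      1+Cr∸2≤Cr : suc (C r ∸ 2) ≤ C r
      1+Cr∸2≤Cr = ≤-trans (n≤1+n _) (≤-reflexive (trans (+-comm 2 _) (m∸n+n≡m 2≤Cr)))

  dominates-to-root : ∀ {C C₁ ks₁ u} → u ≢ r → Adj G u r → 2 ≤ C u → C₁ ≗ move u r C → PiecewiseSolution C₁ ks₁ →
                      Dominates C C₁ ks₁
  dominates-to-root {C} {C₁} {ks₁} {u} u≢r ur 2≤Cu C₁≗ sol =
    _ , piecewise-send-root C u≢r ur 2≤Cu (λ w _ → ≤-reflexive (C₁≗ w)) sol , ≤-reflexive bound
    where
    bound : C₁ r + sum ks₁ ≡ C r + sum (λ i → ks₁ i + single (comp u) 1 i)
    bound = begin
      C₁ r + sum ks₁                                  ≡⟨ cong (_+ sum ks₁) (trans (C₁≗ r) (move-target C u≢r)) ⟩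
      suc (C r) + sum ks₁                             ≡⟨ ≡.sym (+-suc (C r) (sum ks₁)) ⟩
      C r + suc (sum ks₁)                             ≡⟨ cong (C r +_) (trans (+-comm 1 _) (≡.sym (sum-+-single ks₁ (comp u) 1))) ⟩
      C r + sum (λ i → ks₁ i + single (comp u) 1 i)   ∎
      where open ≡-Reasoning

  dominates-inner : ∀ {C C₁ ks₁ u v} → u ≢ r → v ≢ r → comp u ≡ comp v → Adj G u v → 2 ≤ C u →
                    C₁ ≗ move u v C → PiecewiseSolution C₁ ks₁ → Dominates C C₁ ks₁
  dominates-inner {C} {C₁} {ks₁} u≢r v≢r comp≡ uv 2≤Cu C₁≗ sol =
    ks₁ , piecewise-inner C u≢r (v≢r , ≡.sym comp≡) uv 2≤Cu (λ w _ → ≤-reflexive (C₁≗ w)) sol ,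
    ≤-reflexive (cong (_+ sum ks₁) (trans (C₁≗ r) (move-other C (u≢r ∘ ≡.sym) (v≢r ∘ ≡.sym))))

  -- A step between pieces is replaced by the step u → r in the piece of u; the piece of v
  -- then lacks the pebble that arrived at v, which costs it at most one fold.
  dominates-cross : ∀ {C C₁ ks₁ u v} → u ≢ r → v ≢ r → Adj G u r → 2 ≤ C u →
                    C₁ ≗ move u v C → PiecewiseSolution C₁ ks₁ → Dominates C C₁ ks₁
  dominates-cross {C} {C₁} {ks₁} {u} {v} u≢r v≢r ur 2≤Cu C₁≗ sol =
    ks , piecewise-send-root C u≢r ur 2≤Cu (λ w _ → ≤-refl) (piecewise-gain (move u r C) v C₁≤ sol) , bound
    where
    ks : Fin j → ℕ
    ks i = (ks₁ i ∸ single (comp v) 1 i) + single (comp u) 1 i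
    C₁≤ : ∀ w → w ≢ r → C₁ w ≤ move u r C w + single v 1 w
    C₁≤ w w≢r = by-cases (w ≟ u)
      where
      by-cases : Dec (w ≡ u) → C₁ w ≤ move u r C w + single v 1 w
      by-cases (yes refl) = subst₂ (λ a b → a ≤ b + single v 1 w) (≡.sym (trans (C₁≗ w) (move-source w v C)))
                                   (≡.sym (move-source w r C)) (m≤m+n _ _)
      by-cases (no w≢u) = subst₂ (λ a b → a ≤ b + single v 1 w) (≡.sym (C₁≗ w)) (≡.sym (move-other C w≢u w≢r))
                                 (move-≤-single u v w C w≢u)
    bound : C₁ r + sum ks₁ ≤ C r + sum ks
    bound = begin
      C₁ r + sum ks₁
        ≡⟨ cong (_+ sum ks₁) (trans (C₁≗ r) (move-other C (u≢r ∘ ≡.sym) (v≢r ∘ ≡.sym))) ⟩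
      C r + sum ks₁
        ≤⟨ +-monoʳ-≤ (C r) (sum-∸-single ks₁ (comp v)) ⟩
      C r + suc (sum (λ i → ks₁ i ∸ single (comp v) 1 i))
        ≡⟨ cong (C r +_) (trans (+-comm 1 _) (≡.sym (sum-+-single _ (comp u) 1))) ⟩
      C r + sum ks
        ∎
      where open ≤-Reasoning

  -- Only the cross case is classical: that the edge lies in E_r is not decidable.
  step-dominated : ∀ {C C₁ ks₁} → Step G Whole C C₁ → PiecewiseSolution C₁ ks₁ → ¬ ¬ Dominates C C₁ ks₁
  step-dominated (u , v , _ , _ , uv , 2≤Cu , C₁≗) sol with u ≟ r | v ≟ r
  ... | yes refl | yes refl = contradiction uv (irrefl G)
  ... | yes refl | no v≢r   = contradiction (dominates-from-root v≢r 2≤Cu C₁≗ sol)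
  ... | no u≢r   | yes refl = contradiction (dominates-to-root u≢r uv 2≤Cu C₁≗ sol)
  ... | no u≢r   | no v≢r with comp u ≟ comp v
  ...   | yes comp≡ = contradiction (dominates-inner u≢r v≢r comp≡ uv 2≤Cu C₁≗ sol)
  ...   | no comp≢  = ¬¬-map (λ ur → dominates-cross u≢r v≢r ur 2≤Cu C₁≗ sol)
                             (cross-edge⇒¬¬adjacent-root u≢r v≢r uv comp≢)

  steps-dominated : ∀ {C C' ks'} → Star (Step G Whole) C C' → PiecewiseSolution C' ks' → ¬ ¬ Dominates C C' ks'
  steps-dominated ε sol' = contradiction (_ , sol' , ≤-refl)
  steps-dominated (step ◅ rest) sol' ¬dominated =
    steps-dominated rest sol' λ (ks₁ , sol₁ , bound₁) →
      step-dominated step sol₁ λ (ks , sol , bound) → ¬dominated (ks , sol , ≤-trans bound₁ bound)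

  solvable⇒¬¬piecewise : ∀ {t C} → Solvable G Whole r t C → ¬ ¬ (∃ λ ks → PiecewiseSolution C ks × t ≤ C r + sum ks)
  solvable⇒¬¬piecewise {t} (C' , C↝C' , t≤C'r) =
    ¬¬-map (λ (ks , sol , bound) → ks , sol , ≤-trans t≤ bound)
           (steps-dominated C↝C' λ i → restrict i C' , ε , z≤n)
    where
    t≤ : t ≤ C' r + sum {j} (λ _ → 0)
    t≤ = subst (t ≤_) (≡.sym (trans (cong (C' r +_) (sum-replicate-zero j)) (+-identityʳ _))) t≤C'r

  module Union (Ds : Fin j → Config n) (Ds-supported : ∀ i → Supported (Piece i) (Ds i)) where

    ⋃ : Config n
    ⋃ w = sum (λ i → Ds i w)

    size-⋃ : sum ⋃ ≡ sum (λ i → sum (Ds i))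
    size-⋃ = ∑-comm (λ w i → Ds i w)

    ⋃-in : ∀ {i w} → InComponent i w → ⋃ w ≡ Ds i w
    ⋃-in {i} {w} (w≢r , comp≡) = sum-concentrated (λ l → Ds l w) i λ l l≢i → Ds-supported l w λ
      { (inj₁ w≡r) → w≢r w≡r
      ; (inj₂ (_ , comp≡l)) → l≢i (trans (≡.sym comp≡l) comp≡) }

    -- Ds i is the share of ⋃ on Gᵢ plus Ds i r extra pebbles on r.
    folds-bounded : ∀ {i k} → InPiece.Solves i k (restrict i ⋃) → InPiece.Solves i (k + Ds i r) (Ds i)
    folds-bounded {i} {k} sol =
      subst (λ d → InPiece.Solves i (k + d) (Ds i)) (single-≡ r (Ds i r))
        (InPiece.solves-frame i (single r (Ds i r)) (Ds i) sol
          (restrict-⊕-single-≼ ⋃ (Ds i) (Ds i r) ≤-refl λ w w∈ → ≤-reflexive (⋃-in w∈)))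

    ¬solvable-⋃ : ∀ {t} (T : Fin j → ℕ) → sum T + 1 ≡ t + j → (∀ i → ¬ InPiece.Solves i (T i) (Ds i)) →
                  ¬ Solvable G Whole r t ⋃
    ¬solvable-⋃ {t} T ΣT unsolvable sol = solvable⇒¬¬piecewise sol λ (ks , sol-ks , t≤) →
      <⇒≱ (value<t ks sol-ks) t≤
      where
      fold<T : ∀ ks → PiecewiseSolution ⋃ ks → ∀ i → ks i + Ds i r < T i
      fold<T ks sol-ks i with T i ≤? ks i + Ds i r
      ... | yes T≤ = contradiction (InPiece.solves-≤ i T≤ (folds-bounded (sol-ks i))) (unsolvable i)
      ... | no  T≰ = ≰⇒> T≰
      value<t : ∀ ks → PiecewiseSolution ⋃ ks → ⋃ r + sum ks < t
      value<t ks sol-ks = +-cancelʳ-≤ j _ t (begin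
        suc (⋃ r + sum ks + j)                  ≡⟨ cong (λ x → suc (x + j)) (≡.sym (∑-distrib-+ (λ i → Ds i r) ks)) ⟩
        suc (sum (λ i → Ds i r + ks i) + j)     ≡⟨ cong suc (≡.sym (sum-+-ones (λ i → Ds i r + ks i))) ⟩
        suc (sum (λ i → suc (Ds i r + ks i)))   ≤⟨ s≤s (sum-mono-≤ λ i → subst (λ x → suc x ≤ T i) (+-comm (ks i) (Ds i r))
                                                                                (fold<T ks sol-ks i)) ⟩
        suc (sum T)                             ≡⟨ trans (+-comm 1 _) ΣT ⟩
        t + j                                   ∎)
        where open ≤-Reasoning

  module Bounds (t : ℕ) (1≤t : 1 ≤ t) (π : ℕ → Fin j → ℕ)
    (isπ : ∀ s i → 1 ≤ s → IsPebblingNumber G (Piece i) r s (π s i)) where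

    module πᵢ (i : Fin j) = PebblingNumber G (Piece i) r (inj₁ refl) (λ s → π s i) (λ s → isπ s i)

    value : (Fin j → ℕ) → ℕ
    value ts = sum (λ i → π (ts i) i) ∸ j + 1

    lower-bound : ∀ (T : Fin j → ℕ) {m} → IsComposition (t + j ∸ 1) T → m < value T →
                  ¬ AllSolvable G Whole r t m
    lower-bound T {m} (1≤T , ΣT) m<value all = ¬¬-shift-Fin j Unsolvable unsolvable λ Ds →
      let open Union (proj₁ ∘ Ds) (proj₁ ∘ proj₂ ∘ Ds)
      in ¬solvable-⋃ T ΣT+1 (proj₂ ∘ proj₂ ∘ proj₂ ∘ Ds)
           (Pebbling.allSolvable-mono G Whole r (m≤size-⋃ (proj₁ ∘ Ds) (proj₁ ∘ proj₂ ∘ proj₂ ∘ Ds)) all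
             ⋃ (λ _ ¬⊤ → contradiction tt ¬⊤) (sumFin≡sum ⋃))
      where
      ΣT+1 : sum T + 1 ≡ t + j
      ΣT+1 = trans (cong (_+ 1) ΣT) (m∸n+n≡m (≤-trans 1≤t (m≤m+n t j)))
      Unsolvable : Fin j → Set
      Unsolvable i = ∃ λ D → Supported (Piece i) D × sumFin D ≡ π (T i) i ∸ 1 × ¬ InPiece.Solves i (T i) D
      unsolvable : ∀ i → ¬ ¬ Unsolvable i
      unsolvable i = InPiece.¬allSolvable⇒¬¬unsolvable i
        (proj₂ (isπ (T i) i (1≤T i)) _ (∸-monoʳ-< (s≤s z≤n) (πᵢ.π-positive i (1≤T i))))
      m≤size-⋃ : (Ds : Fin j → Config n) → (∀ i → sumFin (Ds i) ≡ π (T i) i ∸ 1) →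
                 m ≤ sum (λ w → sum (λ i → Ds i w))
      m≤size-⋃ Ds size≡ = begin
        m                                                 ≤⟨ m<1+n⇒m≤n (subst (m <_) (+-comm _ 1) m<value) ⟩
        sum (λ i → π (T i) i) ∸ j                         ≡⟨ cong (_∸ j) (≡.sym Σπ) ⟩
        sum (λ i → π (T i) i ∸ 1) + j ∸ j                 ≡⟨ m+n∸n≡m _ j ⟩
        sum (λ i → π (T i) i ∸ 1)                         ≡⟨ sum-cong-≗ (λ i → trans (≡.sym (size≡ i)) (sumFin≡sum (Ds i))) ⟩
        sum (λ i → sum (Ds i))                            ≡⟨ ∑-comm Ds ⟩
        sum (λ w → sum (λ i → Ds i w))                    ∎
        where
        open ≤-Reasoning
        Σπ : sum (λ i → π (T i) i ∸ 1) + j ≡ sum (λ i → π (T i) i)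
        Σπ = trans (≡.sym (sum-+-ones (λ i → π (T i) i ∸ 1)))
                   (sum-cong-≗ λ i → trans (+-comm 1 _) (m∸n+n≡m (πᵢ.π-positive i (1≤T i))))

    module UpperBound (i₀ : Fin j) (M : ℕ) (M-max : ∀ ts → IsComposition (t + j ∸ 1) ts → value ts ≤ M) where

      module _ (C : Config n) where

        share : Fin j → ℕ
        share i = sum (restrict i C)

        fold : Fin j → ℕ
        fold i = lastBelow (λ s → π s i ≤? share i) t

        solves-fold : ∀ i → Solvable G Whole r (fold i) (restrict i C)
        solves-fold i with fold i in fold≡
        ... | zero  = restrict i C , ε , z≤n
        ... | suc s = InPiece.solves-in-G i
                        (InPiece.allSolvable-mono i π≤share (proj₁ (isπ (suc s) i (s≤s z≤n)))
                          (restrict i C) (restrict-supported i C) (sumFin≡sum (restrict i C)))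
          where
          π≤share : π (suc s) i ≤ share i
          π≤share = subst (λ f → π f i ≤ share i) fold≡
                          (lastBelow-satisfies (λ s → π s i ≤? share i) t (subst (1 ≤_) (≡.sym fold≡) (s≤s z≤n)))

        solvable-piecewise : Solvable G Whole r (C r + sum fold) C
        solvable-piecewise =
          Pebbling.solves-mono G Whole r C
            (Pebbling.solves-⊕ G Whole r (single r (C r)) _ (single r (C r) , ε , ≤-reflexive (≡.sym (single-≡ r (C r))))
              (Pebbling.solves-∑ G Whole r (λ i → restrict i C) fold solves-fold))
            (≤-reflexive ∘ ≡.sym ∘ decompose C)

        raised : ℕ → Fin j → ℕ
        raised E i = suc (fold i) + single i₀ E i

        raised-composition : sum fold < t → IsComposition (t + j ∸ 1) (raised (t ∸ 1 ∸ sum fold))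
        raised-composition Σfold<t = (λ i → s≤s z≤n) , (begin
          sum (raised E)      ≡⟨ trans (sum-+-single (suc ∘ fold) i₀ E) (cong (_+ E) (sum-+-ones fold)) ⟩
          sum fold + j + E    ≡⟨ rearrange (sum fold) j E ⟩
          E + sum fold + j    ≡⟨ cong (_+ j) (m∸n+n≡m (∸-monoˡ-≤ 1 Σfold<t)) ⟩
          t ∸ 1 + j           ≡⟨ ≡.sym (+-∸-comm j 1≤t) ⟩
          t + j ∸ 1           ∎)
          where
          open ≡-Reasoning
          E : ℕ
          E = t ∸ 1 ∸ sum fold
          rearrange : ∀ b j e → b + j + e ≡ e + b + j
          rearrange = solve-∀

        -- Every fold is as large as the pebbles in its piece allow, and E ≥ C r covers the root.
        raised-value : ∀ E → sum fold < t → C r ≤ E → sum C + j ≤ sum (λ i → π (raised E i) i)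
        raised-value E Σfold<t Cr≤E = begin
          sum C + j                                          ≡⟨ cong (_+ j) (size-decompose C) ⟩
          C r + sum share + j                                ≡⟨ rearrange (C r) (sum share) j ⟩
          sum share + j + C r                                ≤⟨ +-monoʳ-≤ _ Cr≤E ⟩
          sum share + j + E                                  ≡⟨ cong (_+ E) (≡.sym (sum-+-ones share)) ⟩
          sum (suc ∘ share) + E                              ≤⟨ +-monoˡ-≤ E (sum-mono-≤ share<π) ⟩
          sum (λ i → π (suc (fold i)) i) + E                 ≡⟨ ≡.sym (sum-+-single _ i₀ E) ⟩
          sum (λ i → π (suc (fold i)) i + single i₀ E i)     ≤⟨ sum-mono-≤ (λ i → πᵢ.π-+ i (single i₀ E i) (s≤s z≤n)) ⟩
          sum (λ i → π (raised E i) i)                       ∎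
          where
          open ≤-Reasoning
          rearrange : ∀ c s j → c + s + j ≡ s + j + c
          rearrange = solve-∀
          share<π : ∀ i → suc (share i) ≤ π (suc (fold i)) i
          share<π i = ≰⇒> (lastBelow-last (λ s → π s i ≤? share i) t (≤-<-trans (term≤sum fold i) Σfold<t))

        enough-folds : sum C ≡ M → t ≤ C r + sum fold
        enough-folds size≡ with t ≤? C r + sum fold
        ... | yes t≤ = t≤
        ... | no  t≰ = contradiction (M-max _ (raised-composition Σfold<t)) (<⇒≱ M<value)
          where
          Σfold<t : sum fold < t
          Σfold<t = ≤-<-trans (m≤n+m (sum fold) (C r)) (≰⇒> t≰)
          M+j≤ : M + j ≤ sum (λ i → π (raised (t ∸ 1 ∸ sum fold) i) i)
          M+j≤ = subst (λ m → m + j ≤ sum (λ i → π (raised (t ∸ 1 ∸ sum fold) i) i)) size≡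
                       (raised-value _ Σfold<t (m+n≤o⇒m≤o∸n (C r) (∸-monoˡ-≤ 1 (≰⇒> t≰))))
          M<value : M < value (raised (t ∸ 1 ∸ sum fold))
          M<value = subst (M <_) (+-comm 1 _) (s≤s (m+n≤o⇒m≤o∸n M M+j≤))

      allSolvable-M : AllSolvable G Whole r t M
      allSolvable-M C _ size≡ =
        Pebbling.solves-≤ G Whole r (enough-folds C (trans (≡.sym (sumFin≡sum C)) size≡)) (solvable-piecewise C)

theorem17 : ∀ {n} (G : Graph n) → Connected G → (r : Fin n) → (t : ℕ) → 1 ≤ t →
    (Er : Fin n → Fin n → Set) →
    (∀ u v → Er u v → Adj G u v × Adj G r u × Adj G r v) →
    (j : ℕ) → 1 < j → (comp : Fin n → Fin j) → IsComponentLabelling G r Er j comp →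
    (p : ℕ → Fin j → ℕ) →
    (∀ s i → 1 ≤ s → IsPebblingNumber G (PieceSet r comp i) r s (p s i)) →
    ∃ λ M → IsMaxValue t j p M × IsPebblingNumber G Whole r t M
theorem17 G _ r t 1≤t Er Er⊆ j@(suc (suc k)) (s≤s (s≤s z≤n)) comp labelling p isπ =
  value T , ((T , composition⇒admissible {t} T T-composition , value≡) , T-max) ,
  allSolvable-M , λ m m< → lower-bound T T-composition m<
  where
  open Decomposition G r Er Er⊆ j comp labelling
  open Bounds t 1≤t p isπ
  best : MaximalComposition (suc k) p (t + j ∸ 1)
  best = maximal-composition (suc k) p (t + j ∸ 1)
  T : Fin j → ℕ
  T = proj₁ best
  T-composition : IsComposition (t + j ∸ 1) T
  T-composition = proj₁ (proj₂ best) (m+n≤o⇒m≤o∸n j (subst (_≤ t + j) (+-comm 1 j) (+-monoˡ-≤ j 1≤t)))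
  value-max : ∀ ts → IsComposition (t + j ∸ 1) ts → value ts ≤ value T
  value-max ts ts-composition = +-monoˡ-≤ 1 (∸-monoˡ-≤ j (proj₂ (proj₂ best) ts ts-composition))
  value≡ : ∀ {ts} → value ts ≡ sumFin (λ i → p (ts i) i) ∸ j + 1
  value≡ {ts} = cong (λ x → x ∸ j + 1) (≡.sym (sumFin≡sum (λ i → p (ts i) i)))
  T-max : ∀ ts → Admissible t j ts → sumFin (λ i → p (ts i) i) ∸ j + 1 ≤ value T
  T-max ts adm = subst (_≤ value T) value≡ (value-max ts (admissible⇒composition {t} ts adm))
  open UpperBound fzero (value T) value-max
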